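{- Let $G$ be a finite simple graph with connected components $G_1,\dots,G_k$. Then there is a cellular surjection $\eta:\mathcal{K}G\to \mathcal{K}G_1\times\cdots\times\mathcal{K}G_k$.
   Context: For a finite simple graph $G$ with node set $V$: a tube is a nonempty set of nodes inducing a connected subgraph, and $V$ is the universal tube (even if $G$ is disconnected). Tubes are compatible if nested or far apart (their union does not induce a connected subgraph). A tubing is a set of pairwise compatible tubes containing $V$; if $G$ is disconnected with components $G_1,\dots,G_k$, a tubing may not contain all of the node sets of $G_1,\dots,G_k$. $\mathcal{K}G$ (the graph associahedron) is a polytope whose face poset is isomorphic to the poset of tubings of $G$, with $U\prec U'$ iff $U$ is obtained from $U'$ by adding tubes; the face poset of a product of polytopes is the product of their face posets. A cellular surjection from a polytope $P$ to a polytope $Q$ is a map $f$ from the face poset of $P$ onto the face poset of $Q$ such that whenever $x$ is a subface of $y$, $f(x)$ is a subface of or equal to $f(y)$. -}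

module Defs where

open import Data.Nat using (ℕ)
open import Data.Bool using (Bool; true; false)
open import Data.Fin using (Fin)
open import Data.Fin.Subset using (Subset; _∈_; _∉_; _⊆_; _∪_; ⊤; Nonempty)
open import Data.Product using (Σ; ∃; _×_; _,_)
open import Data.Sum using (_⊎_)
open import Relation.Nullary using (¬_)
open import Relation.Binary.PropositionalEquality using (_≡_)

record Graph (n : ℕ) : Set where
  field
    adj    : Fin n → Fin n → Bool
    sym    : ∀ u v → adj u v ≡ adj v u
    irrefl : ∀ u → adj u u ≡ false
open Graph public

-- Walks from u to v all of whose nodes after u lie in S (u itself is required
-- to lie in S by the users of this type): paths in the induced subgraph G[S].
data Reach {n : ℕ} (G : Graph n) (S : Subset n) : Fin n → Fin n → Set where
  here : ∀ {u} → Reach G S u u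
  step : ∀ {u w v} → adj G u w ≡ true → w ∈ S → Reach G S w v → Reach G S u v

Connected : ∀ {n} → Graph n → Subset n → Set
Connected G S = ∀ u v → u ∈ S → v ∈ S → Reach G S u v

-- We work with induced subgraphs G[W] of G (node set W ⊆ V).  The graph G
-- itself is G[⊤]; a connected component G_i with node set C_i is G[C_i].

IsTube : ∀ {n} → Graph n → Subset n → Subset n → Set
IsTube G W t = t ⊆ W × Nonempty t × Connected G t

IsComponent : ∀ {n} → Graph n → Subset n → Subset n → Set
IsComponent G W C =
  C ⊆ W × Nonempty C × Connected G C ×
  (∀ u v → u ∈ C → v ∈ W → adj G u v ≡ true → v ∈ C)

Compatible : ∀ {n} → Graph n → Subset n → Subset n → Set
Compatible G t₁ t₂ = t₁ ⊆ t₂ ⊎ t₂ ⊆ t₁ ⊎ ¬ Connected G (t₁ ∪ t₂)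

TubeSet : ℕ → Set
TubeSet n = Subset n → Bool

-- Tubings of G[W]: sets of pairwise compatible tubes (W itself being the
-- universal tube) containing W; if G[W] is disconnected, not all of the
-- component node sets belong to it.
IsTubing : ∀ {n} → Graph n → Subset n → TubeSet n → Set
IsTubing G W T =
  (∀ t → T t ≡ true → IsTube G W t ⊎ t ≡ W) ×
  (∀ t₁ t₂ → T t₁ ≡ true → T t₂ ≡ true → Compatible G t₁ t₂) ×
  T W ≡ true ×
  (¬ Connected G W → ¬ (∀ C → IsComponent G W C → T C ≡ true))

-- The face poset of KG[W]: tubings, with U ≼ U' (U a face of U', or equal)
-- iff U is obtained from U' by adding tubes, i.e. U' ⊆ U.
Face : ∀ {n} → Graph n → Subset n → Set
Face {n} G W = Σ (TubeSet n) (IsTubing G W)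

_≼_ : ∀ {n} {G : Graph n} {W : Subset n} → Face G W → Face G W → Set
(U , _) ≼ (U' , _) = ∀ t → U' t ≡ true → U t ≡ true

ProdFace : ∀ {n k} → Graph n → (Fin k → Subset n) → Set
ProdFace G Cs = ∀ i → Face G (Cs i)

_≼ₚ_ : ∀ {n k} {G : Graph n} {Cs : Fin k → Subset n} →
       ProdFace G Cs → ProdFace G Cs → Set
x ≼ₚ y = ∀ i → x i ≼ y i

-- Cellular surjection between face posets: an order-preserving map that is
-- onto (equality of faces = mutual ≼, i.e. equality of the tube sets).
IsCellularSurjection : ∀ {A B : Set} → (A → A → Set) → (B → B → Set) → (A → B) → Set
IsCellularSurjection _≤A_ _≤B_ f =
  (∀ x y → x ≤A y → f x ≤B f y) ×
  (∀ y → ∃ λ x → f x ≤B y × y ≤B f x)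

AreComponents : ∀ {n k} → Graph n → (Fin k → Subset n) → Set
AreComponents G Cs =
  (∀ i → IsComponent G ⊤ (Cs i)) ×
  (∀ i j → Cs i ≡ Cs j → i ≡ j) ×
  (∀ C → IsComponent G ⊤ C → ∃ λ i → Cs i ≡ C)

module Submission where

-- A graph G with components C₁,…,C_k maps cellularly onto KG₁ × ⋯ × KG_k
-- by restriction: η(U)ᵢ is Cᵢ together with the tubes of U inside Cᵢ, and
-- order preservation is immediate.  For surjectivity, a family (Yᵢ)ᵢ of
-- tubings of the components is assembled into the tubing of G made of the
-- universal tube and all proper members of all the Yᵢ; restricting it back
-- to Cᵢ returns Yᵢ.  Members from different components are far apart, since
-- a walk joining them stays inside one component.  For the side condition
-- on disconnected graphs: no component other than the whole node set is
-- assembled, and a graph whose only component is everything is connected.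
-- Constructively the latter holds under double negation (components are
-- built from decisions of reachability, available under ¬¬ for finitely
-- many nodes), which suffices since the side condition is a negation.

open import Defs
open import Data.Nat using (ℕ; zero; suc)
open import Data.Bool using (true)
import Data.Bool as Bool
open import Data.Fin using (Fin; zero; suc)
import Data.Fin.Properties as Fin
open import Data.Fin.Subset using (Subset; ⊤; _∈_; _⊆_; _∪_; Nonempty)
open import Data.Fin.Subset.Properties using (∈⊤; ⊆⊤; ⊆-antisym; _⊆?_; x∈p∪q⁺; x∈p∪q⁻)
open import Data.Product using (Σ; ∃; _×_; _,_; proj₁; proj₂)
open import Data.Sum using (_⊎_; inj₁; inj₂; [_,_]′)
open import Data.Vec using (tabulate)
open import Data.Vec.Properties using (≡-dec; lookup∘tabulate; lookup⇒[]=; []=⇒lookup)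
open import Function using (_∘_; id)
open import Relation.Nullary using (¬_; Dec; yes; no; does; ¬?; contradiction)
open import Relation.Nullary.Decidable using (_×-dec_; _⊎-dec_; dec-true; ¬¬-excluded-middle)
open import Relation.Binary.PropositionalEquality using (_≡_; _≢_; refl; trans; subst)
  renaming (sym to ≡-sym)

decided : ∀ {P : Set} (P? : Dec P) → does P? ≡ true → P
decided (yes p) _ = p
decided (no _)  ()

¬¬-decide-all : ∀ m (P : Fin m → Set) → ¬ ¬ ((i : Fin m) → Dec (P i))
¬¬-decide-all zero    P give = give (λ ())
¬¬-decide-all (suc m) P give =
  ¬¬-excluded-middle λ P₀? → ¬¬-decide-all m (P ∘ suc) λ Pₛ? →
    give λ { zero → P₀? ; (suc i) → Pₛ? i }

_≟ˢ_ : ∀ {n} (s t : Subset n) → Dec (s ≡ t)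
_≟ˢ_ = ≡-dec Bool._≟_

module _ {n : ℕ} (G : Graph n) where

  reach-trans : ∀ {S a b c} → Reach G S a b → Reach G S b c → Reach G S a c
  reach-trans here           r′ = r′
  reach-trans (step e w∈S r) r′ = step e w∈S (reach-trans r r′)

  reach-snoc : ∀ {S a b c} → Reach G S a b → adj G b c ≡ true → c ∈ S → Reach G S a c
  reach-snoc r e c∈S = reach-trans r (step e c∈S here)

  reach-reverse : ∀ {S u v} → u ∈ S → Reach G S u v → Reach G S v u
  reach-reverse u∈S here = here
  reach-reverse {u = u} u∈S (step {w = w} e w∈S r) =
    reach-snoc (reach-reverse w∈S r) (trans (Graph.sym G w u) e) u∈S

  component-closed : ∀ {W C S a v} → IsComponent G W C → S ⊆ W →
                     a ∈ C → Reach G S a v → v ∈ C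
  component-closed cC S⊆W a∈C here = a∈C
  component-closed cC@(_ , _ , _ , closed) S⊆W a∈C (step e w∈S r) =
    component-closed cC S⊆W (closed _ _ a∈C (S⊆W w∈S) e) r

  components-meet⇒equal : ∀ {W C D w} → IsComponent G W C → IsComponent G W D →
                          w ∈ C → w ∈ D → C ≡ D
  components-meet⇒equal cC cD w∈C w∈D =
    ⊆-antisym (contained cC cD w∈C w∈D) (contained cD cC w∈D w∈C)
    where
    contained : ∀ {W C D w} → IsComponent G W C → IsComponent G W D →
                w ∈ C → w ∈ D → C ⊆ D
    contained (C⊆W , _ , connected , _) cD w∈C w∈D v∈C =
      component-closed cD C⊆W w∈D (connected _ _ w∈C v∈C)

  distinct-components-far-apart :
    ∀ {W C D s t} → IsComponent G W C → IsComponent G W D → C ≢ D →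
    s ⊆ C → t ⊆ D → Nonempty s → Nonempty t → ¬ Connected G (s ∪ t)
  distinct-components-far-apart {W} {C} {s = s} {t} cC@(C⊆W , _) cD@(D⊆W , _) C≢D s⊆C t⊆D
                                (a , a∈s) (b , b∈t) connected =
    C≢D (components-meet⇒equal cC cD b∈C (t⊆D b∈t))
    where
    s∪t⊆W : s ∪ t ⊆ W
    s∪t⊆W = [ C⊆W ∘ s⊆C , D⊆W ∘ t⊆D ]′ ∘ x∈p∪q⁻ s t
    b∈C : b ∈ C
    b∈C = component-closed cC s∪t⊆W (s⊆C a∈s)
            (connected a b (x∈p∪q⁺ (inj₁ a∈s)) (x∈p∪q⁺ (inj₂ b∈t)))

  module ReachableFrom (u : Fin n) (reach? : ∀ v → Dec (Reach G ⊤ u v)) where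

    C : Subset n
    C = tabulate (does ∘ reach?)

    reach⇒∈C : ∀ {v} → Reach G ⊤ u v → v ∈ C
    reach⇒∈C {v} r = lookup⇒[]= v C (trans (lookup∘tabulate _ v) (dec-true (reach? v) r))

    ∈C⇒reach : ∀ {v} → v ∈ C → Reach G ⊤ u v
    ∈C⇒reach {v} v∈C = decided (reach? v) (trans (≡-sym (lookup∘tabulate _ v)) ([]=⇒lookup v∈C))

    reach-inside : ∀ {a v} → Reach G ⊤ u a → Reach G ⊤ a v → Reach G C a v
    reach-inside p here = here
    reach-inside p (step e _ r) =
      step e (reach⇒∈C (reach-snoc p e ∈⊤)) (reach-inside (reach-snoc p e ∈⊤) r)

    component : IsComponent G ⊤ C
    component =
      ⊆⊤ , (u , reach⇒∈C here) ,
      (λ a b a∈C b∈C → reach-trans (reach-reverse (reach⇒∈C here) (reach-inside here (∈C⇒reach a∈C)))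
                                   (reach-inside here (∈C⇒reach b∈C))) ,
      (λ a v a∈C _ e → reach⇒∈C (reach-snoc (∈C⇒reach a∈C) e ∈⊤))

  component-exists : (u : Fin n) → ¬ ¬ (∃ λ C → IsComponent G ⊤ C × u ∈ C)
  component-exists u no-component = ¬¬-decide-all n (Reach G ⊤ u) λ reach? →
    let open ReachableFrom u reach? in no-component (C , component , reach⇒∈C here)

  tubing-member-⊆ : ∀ {W U t} → IsTubing G W U → U t ≡ true → t ⊆ W
  tubing-member-⊆ {t = t} (tubes , _) t∈U with tubes t t∈U
  ... | inj₁ (t⊆W , _) = t⊆W
  ... | inj₂ refl      = id

  proper-member-is-tube : ∀ {W U t} → IsTubing G W U → U t ≡ true → t ≢ W → IsTube G W t
  proper-member-is-tube {t = t} (tubes , _) t∈U t≢W with tubes t t∈U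
  ... | inj₁ tube = tube
  ... | inj₂ t≡W  = contradiction t≡W t≢W

  InRestriction : TubeSet n → Subset n → Subset n → Set
  InRestriction U C t = t ≡ C ⊎ (t ⊆ C × U t ≡ true)

  in-restriction? : ∀ U C t → Dec (InRestriction U C t)
  in-restriction? U C t = (t ≟ˢ C) ⊎-dec ((t ⊆? C) ×-dec (U t Bool.≟ true))

  restrict : TubeSet n → Subset n → TubeSet n
  restrict U C t = does (in-restriction? U C t)

  restrict-sound : ∀ {U C} t → restrict U C t ≡ true → InRestriction U C t
  restrict-sound {U} {C} t = decided (in-restriction? U C t)

  restrict-complete : ∀ {U C} t → InRestriction U C t → restrict U C t ≡ true
  restrict-complete {U} {C} t = dec-true (in-restriction? U C t)

  in-restriction-⊆ : ∀ {U C t} → InRestriction U C t → t ⊆ C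
  in-restriction-⊆ (inj₁ refl)     = id
  in-restriction-⊆ (inj₂ (t⊆C , _)) = t⊆C

  restrict-tubing : ∀ {W C U} → C ⊆ W → Connected G C → IsTubing G W U →
                    IsTubing G C (restrict U C)
  restrict-tubing {W} {C} {U} C⊆W connected (tubes , compatible , _) =
    restricted-tubes , restricted-compatible , restrict-complete {U} {C} C (inj₁ refl) ,
    (λ disconnected _ → disconnected connected)
    where
    restricted-tubes : ∀ t → restrict U C t ≡ true → IsTube G C t ⊎ t ≡ C
    restricted-tubes t t∈R with restrict-sound {U} {C} t t∈R
    ... | inj₁ t≡C = inj₂ t≡C
    ... | inj₂ (t⊆C , t∈U) with tubes t t∈U
    ...   | inj₁ (_ , nonempty , t-connected) = inj₁ (t⊆C , nonempty , t-connected)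
    ...   | inj₂ refl                         = inj₂ (⊆-antisym t⊆C C⊆W)
    restricted-compatible : ∀ t₁ t₂ → restrict U C t₁ ≡ true → restrict U C t₂ ≡ true →
                            Compatible G t₁ t₂
    restricted-compatible t₁ t₂ t₁∈R t₂∈R
      with restrict-sound {U} {C} t₁ t₁∈R | restrict-sound {U} {C} t₂ t₂∈R
    ... | inj₁ refl       | t₂∈   = inj₂ (inj₁ (in-restriction-⊆ {U} {C} t₂∈))
    ... | inj₂ (t₁⊆C , _) | inj₁ refl = inj₁ t₁⊆C
    ... | inj₂ (_ , t₁∈U) | inj₂ (_ , t₂∈U) = compatible t₁ t₂ t₁∈U t₂∈U

  restrict-mono : ∀ {U U′ C} → (∀ t → U′ t ≡ true → U t ≡ true) →
                  ∀ t → restrict U′ C t ≡ true → restrict U C t ≡ true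
  restrict-mono {U} {U′} {C} U′⊆U t t∈R with restrict-sound {U′} {C} t t∈R
  ... | inj₁ t≡C           = restrict-complete {U} {C} t (inj₁ t≡C)
  ... | inj₂ (t⊆C , t∈U′) = restrict-complete {U} {C} t (inj₂ (t⊆C , U′⊆U t t∈U′))

sole-component⇒connected : ∀ {n} (G : Graph n) →
  (∀ C → IsComponent G ⊤ C → C ≡ ⊤) → ¬ ¬ Connected G ⊤
sole-component⇒connected {zero}  G sole disconnected = disconnected (λ ())
sole-component⇒connected {suc n} G sole disconnected =
  component-exists G zero λ (C , cC@(_ , _ , connected , _) , _) →
    disconnected (subst (Connected G) (sole C cC) connected)

module ProductDecomposition {n k : ℕ} (G : Graph n) (Cs : Fin k → Subset n)
                            (components : AreComponents G Cs) where

  is-component : ∀ i → IsComponent G ⊤ (Cs i)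
  is-component = proj₁ components

  same-component : ∀ {i j w} → w ∈ Cs i → w ∈ Cs j → i ≡ j
  same-component {i} {j} w∈Cᵢ w∈Cⱼ =
    proj₁ (proj₂ components) i j
      (components-meet⇒equal G (is-component i) (is-component j) w∈Cᵢ w∈Cⱼ)

  restrict-face : Face G ⊤ → ProdFace G Cs
  restrict-face (U , U-tubing) i =
    restrict G U (Cs i) , restrict-tubing G ⊆⊤ (proj₁ (proj₂ (proj₂ (is-component i)))) U-tubing

  restrict-face-mono : ∀ x y → _≼_ {n} {G} {⊤} x y →
                       _≼ₚ_ {n} {k} {G} {Cs} (restrict-face x) (restrict-face y)
  restrict-face-mono (U , _) (U′ , _) U′⊆U i = restrict-mono G {U} {U′} {Cs i} U′⊆U

  ProperMember : ProdFace G Cs → Fin k → Subset n → Set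
  ProperMember Y i t = proj₁ (Y i) t ≡ true × t ≢ Cs i

  component-member : ∀ (Y : ProdFace G Cs) i → proj₁ (Y i) (Cs i) ≡ true
  component-member Y i = proj₁ (proj₂ (proj₂ (proj₂ (Y i))))

  proper-member-tube : ∀ Y {i t} → ProperMember Y i t → IsTube G (Cs i) t
  proper-member-tube Y {i} (t∈Yᵢ , t≢Cᵢ) = proper-member-is-tube G (proj₂ (Y i)) t∈Yᵢ t≢Cᵢ

  InAssembly : ProdFace G Cs → Subset n → Set
  InAssembly Y t = t ≡ ⊤ ⊎ ∃ λ i → ProperMember Y i t

  in-assembly? : ∀ Y t → Dec (InAssembly Y t)
  in-assembly? Y t =
    (t ≟ˢ ⊤) ⊎-dec Fin.any? (λ i → (proj₁ (Y i) t Bool.≟ true) ×-dec ¬? (t ≟ˢ Cs i))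

  assemble : ProdFace G Cs → TubeSet n
  assemble Y t = does (in-assembly? Y t)

  -- Proper members of the tubings are pairwise compatible: within one
  -- component by hypothesis, across components because they are far apart.
  proper-members-compatible : ∀ Y {i j t₁ t₂} → ProperMember Y i t₁ → ProperMember Y j t₂ →
                              Compatible G t₁ t₂
  proper-members-compatible Y {i} {j} {t₁} {t₂} m₁ m₂ with i Fin.≟ j
  ... | yes refl = proj₁ (proj₂ (proj₂ (Y i))) t₁ t₂ (proj₁ m₁) (proj₁ m₂)
  ... | no i≢j   = inj₂ (inj₂ (distinct-components-far-apart G
                     (is-component i) (is-component j) (i≢j ∘ proj₁ (proj₂ components) i j)
                     t₁⊆Cᵢ t₂⊆Cⱼ t₁-nonempty t₂-nonempty))
    where
    t₁⊆Cᵢ : t₁ ⊆ Cs i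
    t₁⊆Cᵢ = proj₁ (proper-member-tube Y m₁)
    t₂⊆Cⱼ : t₂ ⊆ Cs j
    t₂⊆Cⱼ = proj₁ (proper-member-tube Y m₂)
    t₁-nonempty : Nonempty t₁
    t₁-nonempty = proj₁ (proj₂ (proper-member-tube Y m₁))
    t₂-nonempty : Nonempty t₂
    t₂-nonempty = proj₁ (proj₂ (proper-member-tube Y m₂))

  -- No component of G other than the whole node set is assembled: a proper
  -- member of the j-th tubing that is a component would equal Cⱼ.
  assembled-component-is-universal : ∀ Y C → IsComponent G ⊤ C → assemble Y C ≡ true → C ≡ ⊤
  assembled-component-is-universal Y C cC C∈X with decided (in-assembly? Y C) C∈X
  ... | inj₁ C≡⊤ = C≡⊤
  ... | inj₂ (j , member@(_ , C≢Cⱼ)) with proper-member-tube Y member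
  ...   | C⊆Cⱼ , (w , w∈C) , _ =
          contradiction (components-meet⇒equal G cC (is-component j) w∈C (C⊆Cⱼ w∈C)) C≢Cⱼ

  assemble-tubing : ∀ Y → IsTubing G ⊤ (assemble Y)
  assemble-tubing Y =
    assembled-tubes , assembled-compatible , dec-true (in-assembly? Y ⊤) (inj₁ refl) ,
    λ disconnected all-components →
      sole-component⇒connected G
        (λ C cC → assembled-component-is-universal Y C cC (all-components C cC)) disconnected
    where
    assembled-tubes : ∀ t → assemble Y t ≡ true → IsTube G ⊤ t ⊎ t ≡ ⊤
    assembled-tubes t t∈X with decided (in-assembly? Y t) t∈X
    ... | inj₁ t≡⊤ = inj₂ t≡⊤
    ... | inj₂ (i , member) with proper-member-tube Y member
    ...   | _ , nonempty , connected = inj₁ (⊆⊤ , nonempty , connected)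
    assembled-compatible : ∀ t₁ t₂ → assemble Y t₁ ≡ true → assemble Y t₂ ≡ true →
                           Compatible G t₁ t₂
    assembled-compatible t₁ t₂ t₁∈X t₂∈X
      with decided (in-assembly? Y t₁) t₁∈X | decided (in-assembly? Y t₂) t₂∈X
    ... | inj₁ refl     | _             = inj₂ (inj₁ ⊆⊤)
    ... | inj₂ _        | inj₁ refl     = inj₁ ⊆⊤
    ... | inj₂ (_ , m₁) | inj₂ (_ , m₂) = proper-members-compatible Y m₁ m₂

  assemble-face : ProdFace G Cs → Face G ⊤
  assemble-face Y = assemble Y , assemble-tubing Y

  -- Restricting the assembly of Y to Cᵢ gives back exactly the i-th tubing:
  -- a proper member of Yⱼ lying in Cᵢ shares a node with Cᵢ, forcing j = i,
  -- and if the universal tube lies in Cᵢ then Cᵢ is everything.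
  restrict-assemble-⊇ : ∀ Y i t → proj₁ (Y i) t ≡ true →
                        restrict G (assemble Y) (Cs i) t ≡ true
  restrict-assemble-⊇ Y i t t∈Yᵢ =
    restrict-complete G {assemble Y} {Cs i} t (membership (t ≟ˢ Cs i))
    where
    membership : Dec (t ≡ Cs i) → InRestriction G (assemble Y) (Cs i) t
    membership (yes t≡Cᵢ) = inj₁ t≡Cᵢ
    membership (no  t≢Cᵢ) = inj₂ (tubing-member-⊆ G (proj₂ (Y i)) t∈Yᵢ ,
                                 dec-true (in-assembly? Y t) (inj₂ (i , t∈Yᵢ , t≢Cᵢ)))

  restrict-assemble-⊆ : ∀ Y i t → restrict G (assemble Y) (Cs i) t ≡ true →
                        proj₁ (Y i) t ≡ true
  restrict-assemble-⊆ Y i t t∈R with restrict-sound G {assemble Y} {Cs i} t t∈R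
  ... | inj₁ refl = component-member Y i
  ... | inj₂ (t⊆Cᵢ , t∈X) with decided (in-assembly? Y t) t∈X
  ...   | inj₁ refl = subst (λ s → proj₁ (Y i) s ≡ true) (⊆-antisym ⊆⊤ t⊆Cᵢ)
                        (component-member Y i)
  ...   | inj₂ (j , member@(t∈Yⱼ , _)) with proper-member-tube Y member
  ...     | t⊆Cⱼ , (w , w∈t) , _ with same-component (t⊆Cᵢ w∈t) (t⊆Cⱼ w∈t)
  ...       | refl = t∈Yⱼ

lemma2p9 : ∀ {n} (G : Graph n) (k : ℕ) (Cs : Fin k → Subset n) →
    AreComponents G Cs →
    Σ (Face G ⊤ → ProdFace G Cs)
      (IsCellularSurjection (_≼_ {n} {G} {⊤}) (_≼ₚ_ {n} {k} {G} {Cs}))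
lemma2p9 G k Cs components =
  restrict-face , restrict-face-mono ,
  λ Y → assemble-face Y , restrict-assemble-⊇ Y , restrict-assemble-⊆ Y
  where open ProductDecomposition G Cs components
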